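{- If a graph $G$ is connected and trivially perfect, then $\alpha'(G) = \theta_e(G)$.
   Context: A graph is trivially perfect if it contains neither $C_4$ nor $P_4$ as an induced subgraph. For a graph $G$, the edge-clique graph $K_e(G)$ has as its vertices the edges of $G$, two distinct vertices being adjacent when the corresponding edges of $G$ lie in a common clique of $G$; $\alpha'(G) := \alpha(K_e(G))$, the maximum number of edges of $G$ no two of which are contained in a common clique of $G$. $\theta_e(G)$ is the edge-clique covering number: the minimum number of complete subgraphs of $G$ such that every edge of $G$ lies in at least one of them. -}

module Defs where

open import Data.Nat using (ℕ; zero; suc; _≤_)
open import Data.Fin using (Fin; _<_) renaming (zero to f0; suc to fs)
open import Data.Fin.Subset using (Subset; _∈_)
open import Data.Bool using (Bool; true; false)
open import Data.List using (List; length)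
open import Data.List.Membership.Propositional renaming (_∈_ to _∈ₗ_)
open import Data.List.Relation.Unary.Unique.Propositional using (Unique)
open import Data.Product using (Σ; ∃; _×_; _,_; proj₁; proj₂)
open import Relation.Nullary using (¬_)
open import Relation.Binary.PropositionalEquality using (_≡_; _≢_)
open import Function.Definitions using (Injective)

record Graph (n : ℕ) : Set where
  field
    adj    : Fin n → Fin n → Bool
    sym    : ∀ u v → adj u v ≡ adj v u
    irrefl : ∀ u → adj u u ≡ false
open Graph public

data Reachable {n : ℕ} (G : Graph n) : Fin n → Fin n → Set where
  here : ∀ {u} → Reachable G u u
  step : ∀ {u w v} → adj G u w ≡ true → Reachable G w v → Reachable G u v

Connected : ∀ {n} → Graph n → Set
Connected G = ∀ u v → Reachable G u v

-- Pattern graphs on Fin 4.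
-- P4 : 0 - 1 - 2 - 3
P4adj : Fin 4 → Fin 4 → Bool
P4adj f0 (fs f0) = true
P4adj (fs f0) f0 = true
P4adj (fs f0) (fs (fs f0)) = true
P4adj (fs (fs f0)) (fs f0) = true
P4adj (fs (fs f0)) (fs (fs (fs f0))) = true
P4adj (fs (fs (fs f0))) (fs (fs f0)) = true
P4adj _ _ = false

-- C4 : 0 - 1 - 2 - 3 - 0
C4adj : Fin 4 → Fin 4 → Bool
C4adj f0 (fs (fs (fs f0))) = true
C4adj (fs (fs (fs f0))) f0 = true
C4adj i j = P4adj i j

HasInduced4 : ∀ {n} → Graph n → (Fin 4 → Fin 4 → Bool) → Set
HasInduced4 G H =
  Σ (Fin 4 → Fin _) λ f → Injective _≡_ _≡_ f × (∀ i j → adj G (f i) (f j) ≡ H i j)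

TriviallyPerfect : ∀ {n} → Graph n → Set
TriviallyPerfect G = ¬ HasInduced4 G C4adj × ¬ HasInduced4 G P4adj

IsClique : ∀ {n} → Graph n → Subset n → Set
IsClique G K = ∀ u v → u ∈ K → v ∈ K → u ≢ v → adj G u v ≡ true

-- Edges of G, each represented once as an ordered pair (u , v) with u < v.
IsEdge : ∀ {n} → Graph n → Fin n × Fin n → Set
IsEdge G (u , v) = u < v × adj G u v ≡ true

EdgeIn : ∀ {n} → Fin n × Fin n → Subset n → Set
EdgeIn (u , v) K = u ∈ K × v ∈ K

InCommonClique : ∀ {n} → Graph n → Fin n × Fin n → Fin n × Fin n → Set
InCommonClique G e e' = Σ (Subset _) λ K → IsClique G K × EdgeIn e K × EdgeIn e' K

IsEdgeCliqueIndependent : ∀ {n} → Graph n → List (Fin n × Fin n) → Set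
IsEdgeCliqueIndependent G F =
  Unique F × (∀ e → e ∈ₗ F → IsEdge G e) ×
  (∀ e e' → e ∈ₗ F → e' ∈ₗ F → e ≢ e' → ¬ InCommonClique G e e')

IsEdgeCliqueCover : ∀ {n} → Graph n → List (Subset n) → Set
IsEdgeCliqueCover G C =
  (∀ K → K ∈ₗ C → IsClique G K) ×
  (∀ e → IsEdge G e → Σ (Subset _) λ K → K ∈ₗ C × EdgeIn e K)

IsAlphaPrime : ∀ {n} → Graph n → ℕ → Set
IsAlphaPrime G k =
  (Σ (List _) λ F → IsEdgeCliqueIndependent G F × length F ≡ k) ×
  (∀ F → IsEdgeCliqueIndependent G F → length F ≤ k)

IsThetaE : ∀ {n} → Graph n → ℕ → Set
IsThetaE G k =
  (Σ (List _) λ C → IsEdgeCliqueCover G C × length C ≡ k) ×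
  (∀ C → IsEdgeCliqueCover G C → k ≤ length C)

-- Write N[v] for the closed neighbourhood of v and u ≼ v for N[u] ⊆ N[v].
-- In a trivially perfect graph any two adjacent vertices are ≼-comparable:
-- otherwise x ∈ N[a] ∖ N[b] and y ∈ N[b] ∖ N[a] give a path x–a–b–y whose
-- chords xb, ay are missing, i.e. an induced P4 or C4.  Choose in every
-- ≼-class of minimal vertices a canonical representative ℓ (smallest index);
-- call it active if it has a neighbour.  Then
--   * the cliques K ℓ = { w | ℓ ≼ w } over the active representatives cover
--     every edge uv (with u ≼ v take the representative below u), and
--   * one edge at each active representative gives edges no two of which lie
--     in a common clique, because distinct representatives are non-adjacent.
-- Both families have one member per active representative, and weak duality
-- (α' ≤ θ_e, valid in every graph by a pigeonhole argument) turns this pair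
-- of equal-size certificates into α'(G) = θ_e(G).
module Submission where

open import Defs
open import Data.Nat using (ℕ; _≤_; _<_; _≤?_)
open import Data.Nat.Properties using (≤-antisym; ≰⇒>)
open import Data.Nat.Induction using (<-wellFounded)
open import Data.Fin using (Fin; toℕ; _≟_; zero; suc)
open import Data.Fin.Patterns using (0F; 1F; 2F; 3F)
open import Data.Fin.Properties using (toℕ-injective; <-cmp; <⇒≢; all?; any?; ¬∀⟶∃¬; pigeonhole)
open import Data.Fin.Subset using (Subset; _∈_; _∉_; _⊆_; ∣_∣)
open import Data.Fin.Subset.Properties using (_∈?_; _⊆?_; ⊆-trans; ⊆-antisym; p⊂q⇒∣p∣<∣q∣)
open import Data.Bool using (Bool; true; false)
open import Data.Bool.Properties using (¬-not) renaming (_≟_ to _≟ᵇ_)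
open import Data.List using (List; []; _∷_; length; map; filter; allFin; lookup)
open import Data.List.Properties using (length-map)
open import Data.List.Relation.Unary.Any using (here; there; index)
open import Data.List.Relation.Unary.Any.Properties using (lookup-index)
import Data.List.Relation.Unary.All as All
open import Data.List.Relation.Unary.All.Properties using () renaming (map⁺ to All-map⁺)
open import Data.List.Relation.Unary.AllPairs using ([]; _∷_)
open import Data.List.Membership.Propositional using () renaming (_∈_ to _∈ₗ_)
open import Data.List.Membership.Propositional.Properties
  using (∈-lookup; ∈-filter⁺; ∈-filter⁻; ∈-allFin; ∈-map⁺; ∈-map⁻)
open import Data.List.Relation.Unary.Unique.Propositional using (Unique)
open import Data.List.Relation.Unary.Unique.Propositional.Properties using (filter⁺; allFin⁺)
open import Data.Vec using (tabulate)
open import Data.Vec.Properties using (lookup∘tabulate; lookup⇒[]=; []=⇒lookup)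
open import Data.Product using (Σ; ∃; _×_; _,_; proj₁; proj₂)
open import Data.Product.Properties using (≡-dec)
open import Data.Product.Relation.Binary.Lex.Strict using (×-Lex; ×-wellFounded)
open import Data.Sum using (_⊎_; inj₁; inj₂; swap; [_,_])
open import Data.Empty using (⊥-elim)
open import Function using (_on_)
open import Function.Definitions using (Injective)
open import Induction.WellFounded using (Acc; acc)
open import Relation.Binary.Construct.On using () renaming (wellFounded to on-wellFounded)
open import Relation.Binary using (tri<; tri≈; tri>)
open import Relation.Nullary using (¬_; Dec; yes; no; does; contradiction)
open import Relation.Nullary.Decidable using (_→-dec_; _×-dec_; _⊎-dec_; dec-true; decidable-stable; toWitness)
open import Relation.Unary using (Decidable)
open import Relation.Binary.PropositionalEquality using (_≡_; _≢_; refl; trans; cong; subst) renaming (sym to ≡-sym)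

¬→-split : {P Q : Set} → Dec P → ¬ (P → Q) → P × ¬ Q
¬→-split (yes p) ¬p→q = p , λ q → ¬p→q (λ _ → q)
¬→-split (no ¬p) ¬p→q = ⊥-elim (¬p→q (λ p → ⊥-elim (¬p p)))

lookup-injective : {A : Set} {xs : List A} → Unique xs →
  ∀ {i j} → lookup xs i ≡ lookup xs j → i ≡ j
lookup-injective {xs = _ ∷ _}  (_ ∷ _)   {zero}  {zero}  _  = refl
lookup-injective {xs = _ ∷ xs} (x∉ ∷ _)  {zero}  {suc j} eq = ⊥-elim (All.lookup x∉ (∈-lookup {xs = xs} j) eq)
lookup-injective {xs = _ ∷ xs} (x∉ ∷ _)  {suc i} {zero}  eq = ⊥-elim (All.lookup x∉ (∈-lookup {xs = xs} i) (≡-sym eq))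
lookup-injective {xs = _ ∷ _}  (_ ∷ uxs) {suc i} {suc j} eq = cong suc (lookup-injective uxs eq)

relational-pigeonhole : {A B : Set} (R : A → B → Set) {xs : List A} {ys : List B} →
  Unique xs →
  (∀ x → x ∈ₗ xs → Σ B λ y → y ∈ₗ ys × R x y) →
  (∀ {x x' y} → x ∈ₗ xs → x' ∈ₗ xs → y ∈ₗ ys → R x y → R x' y → x ≡ x') →
  length xs ≤ length ys
relational-pigeonhole R {xs} {ys} uxs image functional =
  decidable-stable (length xs ≤? length ys) no-collision
  where
  slot : Fin (length xs) → Fin (length ys)
  slot i = index (proj₁ (proj₂ (image (lookup xs i) (∈-lookup i))))
  witness : ∀ i → lookup ys (slot i) ∈ₗ ys × R (lookup xs i) (lookup ys (slot i))
  witness i with image (lookup xs i) (∈-lookup i)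
  ... | y , y∈ , r = ∈-lookup (index y∈) , subst (R (lookup xs i)) (lookup-index y∈) r
  slot-injective : ∀ {i j} → slot i ≡ slot j → i ≡ j
  slot-injective {i} {j} eq = lookup-injective uxs
    (functional (∈-lookup i) (∈-lookup j) (proj₁ (witness j))
      (subst (λ s → R (lookup xs i) (lookup ys s)) eq (proj₂ (witness i))) (proj₂ (witness j)))
  no-collision : ¬ ¬ (length xs ≤ length ys)
  no-collision ≰ with pigeonhole (≰⇒> ≰) slot
  ... | i , j , i<j , same = <⇒≢ i<j (slot-injective same)

unique-map : {A B : Set} (f : A → B) {xs : List A} →
  (∀ {x y} → x ∈ₗ xs → y ∈ₗ xs → f x ≡ f y → x ≡ y) → Unique xs → Unique (map f xs)
unique-map f inj [] = []
unique-map f inj (x∉ ∷ uxs) =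
  All-map⁺ (All.tabulate λ y∈ fx≡fy → All.lookup x∉ y∈ (inj (here refl) (there y∈) fx≡fy))
  ∷ unique-map f (λ x∈ y∈ → inj (there x∈) (there y∈)) uxs

module _ {n : ℕ} {P : Fin n → Set} (P? : Decidable P) where

  subsetOf : Subset n
  subsetOf = tabulate (λ x → does (P? x))

  ∈subsetOf⁺ : ∀ {x} → P x → x ∈ subsetOf
  ∈subsetOf⁺ {x} px = lookup⇒[]= x subsetOf (trans (lookup∘tabulate _ x) (dec-true (P? x) px))

  ∈subsetOf⁻ : ∀ {x} → x ∈ subsetOf → P x
  ∈subsetOf⁻ {x} x∈ = fromDoes (P? x) (trans (≡-sym (lookup∘tabulate _ x)) ([]=⇒lookup x∈))
    where
    fromDoes : (d : Dec (P x)) → does d ≡ true → P x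
    fromDoes (yes px) _ = px
    fromDoes (no _)   ()

⊈-witness : ∀ {n} {p q : Subset n} → ¬ (p ⊆ q) → ∃ λ x → x ∈ p × x ∉ q
⊈-witness {n} {p} {q} p⊈q
  with ¬∀⟶∃¬ n _ (λ x → (x ∈? p) →-dec (x ∈? q)) (λ incl → p⊈q (λ {x} → incl x))
... | x , ¬incl = x , ¬→-split (x ∈? p) ¬incl

injective₄ : {A : Set} (f : Fin 4 → A) →
  f 0F ≢ f 1F → f 0F ≢ f 2F → f 0F ≢ f 3F → f 1F ≢ f 2F → f 1F ≢ f 3F → f 2F ≢ f 3F →
  Injective _≡_ _≡_ f
injective₄ f d01 d02 d03 d12 d13 d23 = inj
  where
  inj : Injective _≡_ _≡_ f
  inj {0F} {0F} _ = refl
  inj {1F} {1F} _ = refl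
  inj {2F} {2F} _ = refl
  inj {3F} {3F} _ = refl
  inj {0F} {1F} e = ⊥-elim (d01 e)
  inj {0F} {2F} e = ⊥-elim (d02 e)
  inj {0F} {3F} e = ⊥-elim (d03 e)
  inj {1F} {2F} e = ⊥-elim (d12 e)
  inj {1F} {3F} e = ⊥-elim (d13 e)
  inj {2F} {3F} e = ⊥-elim (d23 e)
  inj {1F} {0F} e = ⊥-elim (d01 (≡-sym e))
  inj {2F} {0F} e = ⊥-elim (d02 (≡-sym e))
  inj {3F} {0F} e = ⊥-elim (d03 (≡-sym e))
  inj {2F} {1F} e = ⊥-elim (d12 (≡-sym e))
  inj {3F} {1F} e = ⊥-elim (d13 (≡-sym e))
  inj {3F} {2F} e = ⊥-elim (d23 (≡-sym e))

pathOrCycle : Bool → Fin 4 → Fin 4 → Bool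
pathOrCycle c 0F 3F = c
pathOrCycle c 3F 0F = c
pathOrCycle c i j = P4adj i j

pathOrCycle-true : ∀ i j → pathOrCycle true i j ≡ C4adj i j
pathOrCycle-true = toWitness {a? = all? λ i → all? λ j → pathOrCycle true i j ≟ᵇ C4adj i j} _

pathOrCycle-false : ∀ i j → pathOrCycle false i j ≡ P4adj i j
pathOrCycle-false = toWitness {a? = all? λ i → all? λ j → pathOrCycle false i j ≟ᵇ P4adj i j} _

path-or-cycle : ∀ {n} (G : Graph n) (c : Bool) →
  HasInduced4 G (pathOrCycle c) → HasInduced4 G C4adj ⊎ HasInduced4 G P4adj
path-or-cycle G true  (f , inj , match) = inj₁ (f , inj , λ i j → trans (match i j) (pathOrCycle-true i j))
path-or-cycle G false (f , inj , match) = inj₂ (f , inj , λ i j → trans (match i j) (pathOrCycle-false i j))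

-- Weak duality (any graph): distinct edges of an independent set need
-- distinct covering cliques, so α'(G) ≤ θ_e(G).
weak-duality : ∀ {n} (G : Graph n) {F : List (Fin n × Fin n)} {C : List (Subset n)} →
  IsEdgeCliqueIndependent G F → IsEdgeCliqueCover G C → length F ≤ length C
weak-duality G {F} {C} (uniqueF , edgesF , independentF) (cliquesC , coversC) =
  relational-pigeonhole EdgeIn uniqueF (λ e e∈ → coversC e (edgesF e e∈)) sameEdge
  where
  sameEdge : ∀ {e e' K} → e ∈ₗ F → e' ∈ₗ F → K ∈ₗ C → EdgeIn e K → EdgeIn e' K → e ≡ e'
  sameEdge {e} {e'} {K} e∈ e'∈ K∈ eK e'K = decidable-stable (≡-dec _≟_ _≟_ e e')
    (λ e≢e' → independentF e e' e∈ e'∈ e≢e' (K , cliquesC K K∈ , eK , e'K))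

equal-certificates : ∀ {n} (G : Graph n) (F : List (Fin n × Fin n)) (C : List (Subset n)) →
  IsEdgeCliqueIndependent G F → IsEdgeCliqueCover G C → length F ≡ length C →
  Σ ℕ (λ k → IsAlphaPrime G k × IsThetaE G k)
equal-certificates G F C indF covC |F|≡|C| = length F ,
  ((F , indF , refl) , λ F' indF' → subst (length F' ≤_) (≡-sym |F|≡|C|) (weak-duality G indF' covC)) ,
  ((C , covC , ≡-sym |F|≡|C|) , λ C' covC' → weak-duality G indF covC')

module ClosedNeighbourhoods {n : ℕ} (G : Graph n) where

  _~_ : Fin n → Fin n → Set
  u ~ v = adj G u v ≡ true

  ~-sym : ∀ {u v} → u ~ v → v ~ u
  ~-sym {u} {v} p = trans (Graph.sym G v u) p

  ≁-sym : ∀ {u v} → adj G u v ≡ false → adj G v u ≡ false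
  ≁-sym {u} {v} p = trans (Graph.sym G v u) p

  ~-distinct : ∀ {u v} → u ~ v → u ≢ v
  ~-distinct {u} p refl with trans (≡-sym p) (irrefl G u)
  ... | ()

  -- A path x–a–b–y whose chords xb and ay are missing induces P4 or C4,
  -- according to whether xy is an edge.
  induced-path-or-cycle : ∀ {x a b y} → x ~ a → a ~ b → b ~ y →
    adj G b x ≡ false → adj G a y ≡ false → x ≢ b → a ≢ y → x ≢ y →
    HasInduced4 G C4adj ⊎ HasInduced4 G P4adj
  induced-path-or-cycle {x} {a} {b} {y} xa ab by bx ay x≢b a≢y x≢y =
    path-or-cycle G (adj G x y) (f , f-injective , table)
    where
    f : Fin 4 → Fin n
    f 0F = x
    f 1F = a
    f 2F = b
    f 3F = y
    f-injective : Injective _≡_ _≡_ f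
    f-injective = injective₄ f (~-distinct xa) x≢b x≢y (~-distinct ab) a≢y (~-distinct by)
    table : ∀ i j → adj G (f i) (f j) ≡ pathOrCycle (adj G x y) i j
    table 0F 0F = irrefl G x
    table 0F 1F = xa
    table 0F 2F = ≁-sym bx
    table 0F 3F = refl
    table 1F 0F = ~-sym xa
    table 1F 1F = irrefl G a
    table 1F 2F = ab
    table 1F 3F = ay
    table 2F 0F = bx
    table 2F 1F = ~-sym ab
    table 2F 2F = irrefl G b
    table 2F 3F = by
    table 3F 0F = Graph.sym G y x
    table 3F 1F = ≁-sym ay
    table 3F 2F = ~-sym by
    table 3F 3F = irrefl G y

  Near : Fin n → Fin n → Set
  Near v x = v ≡ x ⊎ v ~ x

  Near? : ∀ v → Decidable (Near v)
  Near? v x = (v ≟ x) ⊎-dec (adj G v x ≟ᵇ true)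

  Near-sym : ∀ {v x} → Near v x → Near x v
  Near-sym (inj₁ refl) = inj₁ refl
  Near-sym (inj₂ v~x)  = inj₂ (~-sym v~x)

  Near-adj : ∀ {v x} → Near v x → v ≢ x → v ~ x
  Near-adj (inj₁ v≡x) v≢x = contradiction v≡x v≢x
  Near-adj (inj₂ v~x) _   = v~x

  ¬Near-≢ : ∀ {v x} → ¬ Near v x → v ≢ x
  ¬Near-≢ ¬near v≡x = ¬near (inj₁ v≡x)

  ¬Near-≁ : ∀ {v x} → ¬ Near v x → adj G v x ≡ false
  ¬Near-≁ ¬near = ¬-not (λ v~x → ¬near (inj₂ v~x))

  N[_] : Fin n → Subset n
  N[ v ] = subsetOf (Near? v)

  _≼_ : Fin n → Fin n → Set
  u ≼ v = N[ u ] ⊆ N[ v ]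

  _≼?_ : ∀ u v → Dec (u ≼ v)
  u ≼? v = N[ u ] ⊆? N[ v ]

  dominated-near : ∀ {ℓ u} → ℓ ≼ u → Near u ℓ
  dominated-near ℓ≼u = ∈subsetOf⁻ (Near? _) (ℓ≼u (∈subsetOf⁺ (Near? _) (inj₁ refl)))

  HasNeighbour : Fin n → Set
  HasNeighbour v = ∃ (v ~_)

  HasNeighbour? : ∀ v → Dec (HasNeighbour v)
  HasNeighbour? v = any? (λ w → adj G v w ≟ᵇ true)

  -- A chosen neighbour of v (v itself when v is isolated).
  partner : Fin n → Fin n
  partner v with HasNeighbour? v
  ... | yes (w , _) = w
  ... | no  _       = v

  partner-adj : ∀ {v} → HasNeighbour v → v ~ partner v
  partner-adj {v} has with HasNeighbour? v
  ... | yes (_ , v~w) = v~w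
  ... | no  none      = contradiction has none

  dominated-neighbour : ∀ {ℓ u v} → ℓ ≼ u → u ~ v → HasNeighbour ℓ
  dominated-neighbour ℓ≼u u~v with dominated-near ℓ≼u
  ... | inj₁ refl = _ , u~v
  ... | inj₂ u~ℓ  = _ , ~-sym u~ℓ

  -- The vertices dominating ℓ form a clique: each of them is near ℓ,
  -- hence lies in the neighbourhood of every other one.
  K : Fin n → Subset n
  K ℓ = subsetOf (ℓ ≼?_)

  K-clique : ∀ ℓ → IsClique G (K ℓ)
  K-clique ℓ u v u∈ v∈ u≢v = Near-adj (Near-sym (∈subsetOf⁻ (Near? v) (ℓ≼v u∈N[ℓ]))) u≢v
    where
    ℓ≼v : ℓ ≼ v
    ℓ≼v = ∈subsetOf⁻ (ℓ ≼?_) v∈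
    u∈N[ℓ] : u ∈ N[ ℓ ]
    u∈N[ℓ] = ∈subsetOf⁺ (Near? ℓ) (Near-sym (dominated-near (∈subsetOf⁻ (ℓ ≼?_) u∈)))

  -- Canonical representatives: ℓ is ≼-minimal and has the smallest index
  -- among the vertices with the same closed neighbourhood.
  IsRep : Fin n → Set
  IsRep ℓ = ∀ w → w ≼ ℓ → ℓ ≼ w × toℕ ℓ ≤ toℕ w

  rep-condition? : ∀ ℓ w → Dec (w ≼ ℓ → ℓ ≼ w × toℕ ℓ ≤ toℕ w)
  rep-condition? ℓ w = (w ≼? ℓ) →-dec ((ℓ ≼? w) ×-dec (toℕ ℓ ≤? toℕ w))

  IsRep? : ∀ ℓ → Dec (IsRep ℓ)
  IsRep? ℓ = all? (rep-condition? ℓ)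

  rep-unique : ∀ {ℓ ℓ'} → IsRep ℓ → IsRep ℓ' → ℓ ≼ ℓ' → ℓ ≡ ℓ'
  rep-unique {ℓ} {ℓ'} rep rep' ℓ≼ℓ' with rep' ℓ ℓ≼ℓ'
  ... | ℓ'≼ℓ , ℓ'≤ℓ = toℕ-injective (≤-antisym (proj₂ (rep ℓ' ℓ'≼ℓ)) ℓ'≤ℓ)

  μ : Fin n → ℕ × ℕ
  μ v = ∣ N[ v ] ∣ , toℕ v

  _⊏_ : Fin n → Fin n → Set
  _⊏_ = ×-Lex _≡_ _<_ _<_ on μ

  descent : ∀ {w a} → w ≼ a → ¬ (a ≼ w × toℕ a ≤ toℕ w) → w ⊏ a
  descent {w} {a} w≼a ¬twin with a ≼? w
  ... | yes a≼w = inj₂ (cong ∣_∣ (⊆-antisym w≼a a≼w) , ≰⇒> (λ a≤w → ¬twin (a≼w , a≤w)))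
  ... | no  a⋠w = inj₁ (p⊂q⇒∣p∣<∣q∣ (w≼a , ⊈-witness a⋠w))

  rep-below : ∀ a → ∃ λ ℓ → IsRep ℓ × ℓ ≼ a
  rep-below a = go a (on-wellFounded μ (×-wellFounded <-wellFounded <-wellFounded) a)
    where
    go : ∀ a → Acc _⊏_ a → ∃ λ ℓ → IsRep ℓ × ℓ ≼ a
    go a (acc smaller) with IsRep? a
    ... | yes rep = a , rep , λ x∈ → x∈
    ... | no ¬rep with ¬∀⟶∃¬ n _ (rep-condition? a) ¬rep
    ...   | w , ¬step with ¬→-split (w ≼? a) ¬step
    ...     | w≼a , ¬twin with go w (smaller (descent w≼a ¬twin))
    ...       | ℓ , rep , ℓ≼w = ℓ , rep , ⊆-trans ℓ≼w w≼a

  edge : Fin n → Fin n → Fin n × Fin n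
  edge u v with <-cmp u v
  ... | tri< _ _ _ = u , v
  ... | tri≈ _ _ _ = u , v
  ... | tri> _ _ _ = v , u

  edge-isEdge : ∀ {u v} → u ~ v → IsEdge G (edge u v)
  edge-isEdge {u} {v} u~v with <-cmp u v
  ... | tri< u<v _ _ = u<v , u~v
  ... | tri≈ _ u≡v _ = ⊥-elim (~-distinct u~v u≡v)
  ... | tri> _ _ v<u = v<u , ~-sym u~v

  Endpoint : Fin n × Fin n → Fin n → Set
  Endpoint (a , b) x = x ≡ a ⊎ x ≡ b

  edge-endpointˡ : ∀ u v → Endpoint (edge u v) u
  edge-endpointˡ u v with <-cmp u v
  ... | tri< _ _ _ = inj₁ refl
  ... | tri≈ _ _ _ = inj₁ refl
  ... | tri> _ _ _ = inj₂ refl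

  edge-endpoints : ∀ {u v x} → Endpoint (edge u v) x → x ≡ u ⊎ x ≡ v
  edge-endpoints {u} {v} e with <-cmp u v
  ... | tri< _ _ _ = e
  ... | tri≈ _ _ _ = e
  ... | tri> _ _ _ = swap e

  endpoint-in : ∀ {e K x} → EdgeIn e K → Endpoint e x → x ∈ K
  endpoint-in (a∈ , _) (inj₁ refl) = a∈
  endpoint-in (_ , b∈) (inj₂ refl) = b∈

module TriviallyPerfectGraphs {n : ℕ} (G : Graph n) (tp : TriviallyPerfect G) where
  open ClosedNeighbourhoods G

  no-C4-or-P4 : ¬ (HasInduced4 G C4adj ⊎ HasInduced4 G P4adj)
  no-C4-or-P4 = [ proj₁ tp , proj₂ tp ]

  comparable : ∀ {a b} → a ~ b → a ≼ b ⊎ b ≼ a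
  comparable {a} {b} a~b with a ≼? b | b ≼? a
  ... | yes a≼b | _       = inj₁ a≼b
  ... | no  _   | yes b≼a = inj₂ b≼a
  ... | no  a⋠b | no  b⋠a
    with ⊈-witness a⋠b | ⊈-witness b⋠a
  ... | x , x∈N[a] , x∉N[b] | y , y∈N[b] , y∉N[a] =
    ⊥-elim (no-C4-or-P4 (induced-path-or-cycle (~-sym a~x) a~b b~y
      (¬Near-≁ ¬Near-b-x) (¬Near-≁ ¬Near-a-y) x≢b a≢y x≢y))
    where
    ¬Near-b-x : ¬ Near b x
    ¬Near-b-x near = x∉N[b] (∈subsetOf⁺ (Near? b) near)
    ¬Near-a-y : ¬ Near a y
    ¬Near-a-y near = y∉N[a] (∈subsetOf⁺ (Near? a) near)
    a~x : a ~ x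
    a~x = Near-adj (∈subsetOf⁻ (Near? a) x∈N[a]) λ { refl → ¬Near-b-x (inj₂ (~-sym a~b)) }
    b~y : b ~ y
    b~y = Near-adj (∈subsetOf⁻ (Near? b) y∈N[b]) λ { refl → ¬Near-a-y (inj₂ a~b) }
    x≢b : x ≢ b
    x≢b x≡b = ¬Near-≢ ¬Near-b-x (≡-sym x≡b)
    a≢y : a ≢ y
    a≢y = ¬Near-≢ ¬Near-a-y
    x≢y : x ≢ y
    x≢y refl = y∉N[a] x∈N[a]

  rep-near : ∀ {ℓ ℓ'} → IsRep ℓ → IsRep ℓ' → Near ℓ ℓ' → ℓ ≡ ℓ'
  rep-near rep rep' (inj₁ ℓ≡ℓ') = ℓ≡ℓ'
  rep-near rep rep' (inj₂ ℓ~ℓ') with comparable ℓ~ℓ'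
  ... | inj₁ ℓ≼ℓ' = rep-unique rep rep' ℓ≼ℓ'
  ... | inj₂ ℓ'≼ℓ = ≡-sym (rep-unique rep' rep ℓ'≼ℓ)

  ActiveRep : Fin n → Set
  ActiveRep ℓ = IsRep ℓ × HasNeighbour ℓ

  ActiveRep? : ∀ ℓ → Dec (ActiveRep ℓ)
  ActiveRep? ℓ = IsRep? ℓ ×-dec HasNeighbour? ℓ

  reps : List (Fin n)
  reps = filter ActiveRep? (allFin n)

  active : ∀ {ℓ} → ℓ ∈ₗ reps → ActiveRep ℓ
  active ℓ∈ = proj₂ (∈-filter⁻ ActiveRep? {xs = allFin n} ℓ∈)

  cover : List (Subset n)
  cover = map K reps

  covered : ∀ {u v} → u ~ v → u ≼ v → Σ (Subset n) λ K' → K' ∈ₗ cover × u ∈ K' × v ∈ K'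
  covered u~v u≼v with rep-below _
  ... | ℓ , rep , ℓ≼u =
    K ℓ , ∈-map⁺ K (∈-filter⁺ ActiveRep? (∈-allFin ℓ) (rep , dominated-neighbour ℓ≼u u~v)) ,
    ∈subsetOf⁺ (ℓ ≼?_) ℓ≼u , ∈subsetOf⁺ (ℓ ≼?_) (⊆-trans ℓ≼u u≼v)

  -- Every edge is covered, using comparability of its endpoints.
  cover-isCover : IsEdgeCliqueCover G cover
  cover-isCover = cliques , covers
    where
    cliques : ∀ K' → K' ∈ₗ cover → IsClique G K'
    cliques K' K'∈ with ∈-map⁻ K K'∈
    ... | ℓ , _ , refl = K-clique ℓ
    covers : ∀ e → IsEdge G e → Σ (Subset n) λ K' → K' ∈ₗ cover × EdgeIn e K'
    covers (u , v) (_ , u~v) with comparable u~v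
    ... | inj₁ u≼v = let K' , K'∈ , u∈ , v∈ = covered u~v u≼v in K' , K'∈ , u∈ , v∈
    ... | inj₂ v≼u = let K' , K'∈ , v∈ , u∈ = covered (~-sym u~v) v≼u in K' , K'∈ , u∈ , v∈

  repEdge : Fin n → Fin n × Fin n
  repEdge ℓ = edge ℓ (partner ℓ)

  independent : List (Fin n × Fin n)
  independent = map repEdge reps

  -- Distinct active representatives get distinct edges: a shared edge would
  -- make one representative the chosen neighbour of the other.
  repEdge-injective : ∀ {ℓ ℓ'} → ℓ ∈ₗ reps → ℓ' ∈ₗ reps → repEdge ℓ ≡ repEdge ℓ' → ℓ ≡ ℓ'
  repEdge-injective {ℓ} {ℓ'} ℓ∈ ℓ'∈ same
    with edge-endpoints (subst (λ e → Endpoint e ℓ) same (edge-endpointˡ ℓ (partner ℓ)))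
  ... | inj₁ ℓ≡ℓ' = ℓ≡ℓ'
  ... | inj₂ refl = rep-near (proj₁ (active ℓ∈)) (proj₁ (active ℓ'∈))
                      (Near-sym (inj₂ (partner-adj (proj₂ (active ℓ'∈)))))

  -- Edges of two active representatives lying in a common clique have
  -- near, hence equal, representatives.
  repEdge-clique : ∀ {ℓ ℓ' K'} → ℓ ∈ₗ reps → ℓ' ∈ₗ reps → IsClique G K' →
    EdgeIn (repEdge ℓ) K' → EdgeIn (repEdge ℓ') K' → ℓ ≡ ℓ'
  repEdge-clique {ℓ} {ℓ'} ℓ∈ ℓ'∈ clique inK inK' with ℓ ≟ ℓ'
  ... | yes ℓ≡ℓ' = ℓ≡ℓ'
  ... | no  ℓ≢ℓ' = rep-near (proj₁ (active ℓ∈)) (proj₁ (active ℓ'∈))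
    (inj₂ (clique ℓ ℓ' (endpoint-in inK (edge-endpointˡ ℓ _)) (endpoint-in inK' (edge-endpointˡ ℓ' _)) ℓ≢ℓ'))

  independent-isIndependent : IsEdgeCliqueIndependent G independent
  independent-isIndependent =
    unique-map repEdge repEdge-injective (filter⁺ ActiveRep? (allFin⁺ n)) , edges , noCommonClique
    where
    edges : ∀ e → e ∈ₗ independent → IsEdge G e
    edges e e∈ with ∈-map⁻ repEdge e∈
    ... | ℓ , ℓ∈ , refl = edge-isEdge (partner-adj (proj₂ (active ℓ∈)))
    noCommonClique : ∀ e e' → e ∈ₗ independent → e' ∈ₗ independent → e ≢ e' → ¬ InCommonClique G e e'
    noCommonClique e e' e∈ e'∈ e≢e' (K' , clique , inK , inK')
      with ∈-map⁻ repEdge e∈ | ∈-map⁻ repEdge e'∈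
    ... | ℓ , ℓ∈ , refl | ℓ' , ℓ'∈ , refl = e≢e' (cong repEdge (repEdge-clique ℓ∈ ℓ'∈ clique inK inK'))

  -- Both certificates have one member per active representative.
  α'≡θₑ : Σ ℕ (λ k → IsAlphaPrime G k × IsThetaE G k)
  α'≡θₑ = equal-certificates G independent cover independent-isIndependent cover-isCover
    (trans (length-map repEdge reps) (≡-sym (length-map K reps)))

mainTheorem3 : (n : ℕ) (G : Graph n) → Connected G → TriviallyPerfect G →
    Σ ℕ (λ k → IsAlphaPrime G k × IsThetaE G k)
mainTheorem3 n G _ tp = TriviallyPerfectGraphs.α'≡θₑ G tp
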